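{- Let $n$ be an even positive integer and write $n=2^{s_1+1}p_2^{s_2}\cdots p_q^{s_q}$ with $s_1\ge0$ and $p_2,\dots,p_q$ distinct odd primes with $s_j\ge1$. The representations $n=k^2-l^2$ with positive integers $k,l$ are exactly $$n=\left(\frac{n+2d}{2\sqrt{2d}}\right)^2-\left(\frac{n-2d}{2\sqrt{2d}}\right)^2,$$ where $d$ ranges over the divisors of $(n/2)^2$ with $d<\frac n2$ of the form $d=2^{2a+1}w^2$ with an integer $a\ge0$ and an odd positive integer $w$. Their number is $$N_r=\frac{s_1(s_2+1)\cdots(s_q+1)}{2}\quad\text{if $n$ is not a perfect square (i.e. $s_1$ even or some of $s_2,\dots,s_q$ odd)},$$ $$N_r=\frac{s_1(s_2+1)\cdots(s_q+1)-1}{2}\quad\text{if $n$ is a perfect square (i.e. $s_1$ odd and all $s_2,\dots,s_q$ even)}.$$ In particular, if $n\equiv 2\pmod 4$ then $n$ has no such representation.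
   Context: Representations $n=k^2-l^2$ are counted as ordered pairs $(k,l)$ of positive integers ($l=0$ is not allowed). -}

module Defs where

open import Data.Nat using (ℕ; zero; suc; _+_; _*_; _^_; _<_; _≤_)
open import Data.Nat.Divisibility using (_∣_)
open import Data.Nat.DivMod using (_/_)
open import Data.Product using (_×_; _,_; Σ; ∃; ∃-syntax)
open import Data.List using (List; []; _∷_; map; length)
open import Data.Nat.ListAction using (product)
open import Data.List.Membership.Propositional using (_∈_)
open import Data.List.Relation.Unary.Unique.Propositional using (Unique)
open import Relation.Binary.PropositionalEquality using (_≡_)
open import Function.Bundles using (_⇔_)

Even : ℕ → Set
Even n = ∃[ t ] n ≡ 2 * t

Odd : ℕ → Set
Odd n = ∃[ t ] n ≡ 1 + 2 * t

IsSquare : ℕ → Set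
IsSquare n = ∃[ m ] m * m ≡ n

Rep : ℕ → ℕ → ℕ → Set
Rep n k l = (0 < k) × (0 < l) × (k * k ≡ n + l * l)

Admissible : ℕ → ℕ → Set
Admissible n d =
  (d ∣ (n / 2) * (n / 2)) × (2 * d < n) ×
  (∃[ a ] ∃[ w ] (Odd w × d ≡ 2 ^ (2 * a + 1) * (w * w)))

-- (k , l) = ((n+2d)/(2√(2d)) , (n−2d)/(2√(2d))), with r = √(2d) (exact, no rounding)
Param : ℕ → ℕ → ℕ → ℕ → Set
Param n d k l = ∃[ r ] ((r * r ≡ 2 * d) × (2 * r * k ≡ n + 2 * d) × (2 * r * l + 2 * d ≡ n))

HasCard : {A : Set} → (A → Set) → ℕ → Set
HasCard {A} P c = Σ (List A) λ xs → Unique xs × (∀ x → (x ∈ xs) ⇔ P x) × (length xs ≡ c)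

-- factorisation data: list of (p_j , s_j), j = 2..q
primePowerProduct : List (ℕ × ℕ) → ℕ
primePowerProduct ps = product (map (λ { (p , s) → p ^ s }) ps)

exponentFactor : List (ℕ × ℕ) → ℕ
exponentFactor ps = product (map (λ { (p , s) → suc s }) ps)

module Submission where

-- For even n the difference k − l = 2u is even, so the representations are exactly
-- k = 2u + l with n = 4u(u + l): they correspond to the divisor pairs u < v of n/4 via
-- (u , v) ↦ (u + v , v − u). The paper's parameter is d = 2u² (so √(2d) = 2u = k − l), and
-- d is admissible precisely when d = 2h² for a divisor pair h < c of n/4; this gives the
-- parametrisation. For the count, the divisor pairs of M = n/4 = 2^(s₁−1) ∏ p_j^s_j are
-- enumerated by choosing an exponent for every prime, giving s₁ ∏ (s_j + 1) pairs without
-- repetition (by uniqueness of p-adic splitting); mirroring u ↔ v shows that there are as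
-- many pairs below the diagonal as above it, and the diagonal holds a pair iff n is a square.

open import Defs
open import Data.Nat using (ℕ; _+_; _*_; _^_; _<_; _≤_)
open import Data.Nat.DivMod using (_%_)
open import Data.Nat.Primality using (Prime)
open import Data.Product using (_×_; _,_; proj₁; proj₂; ∃; ∃-syntax)
open import Data.List using (List; map)
open import Data.List.Relation.Unary.All using (All)
open import Data.List.Relation.Unary.Unique.Propositional using (Unique)
open import Relation.Binary.PropositionalEquality using (_≡_)
open import Relation.Nullary using (¬_)
open import Function.Bundles using (_⇔_)
open import Data.Nat
open import Data.Nat.Properties
open import Data.Nat.Divisibility
open import Data.Nat.DivMod using (_/_; m*n/n≡m; m/n*n≡m; m≡m%n+[m/n]*n)
open import Data.Nat.Primality using (prime[2]; prime⇒nonZero; prime⇒nonTrivial; euclidsLemma; prime⇒irreducible)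
open import Data.Nat.GCD using (gcd; gcd[m,n]∣m; gcd[m,n]∣n; gcd[m,n]≢0)
open import Data.Nat.Coprimality using (Coprime; coprime-divisor; coprime-/gcd)
open import Data.Nat.Induction using (<-rec)
open import Data.Nat.Tactic.RingSolver using (solve-∀)
open import Data.Product using (swap)
open import Data.Sum using (_⊎_; inj₁; inj₂; [_,_]′)
open import Data.Empty using (⊥; ⊥-elim)
open import Relation.Nullary using (Dec; yes; no)
open import Relation.Binary.PropositionalEquality using (_≢_; refl; sym; trans; cong; cong₂; subst; subst₂; module ≡-Reasoning)
open import Relation.Binary.Definitions using (tri<; tri≈; tri>)
open import Data.List using ([]; _∷_; length; _++_; cartesianProductWith; [_]; upTo; filter)
open import Data.List.Properties using (length-++; length-map; length-upTo; filter-accept; filter-reject)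
import Data.List.Relation.Unary.All as All
import Data.List.Relation.Unary.All.Properties as AllP
open import Data.List.Relation.Unary.AllPairs using ([]; _∷_)
import Data.List.Relation.Unary.AllPairs.Properties as AllPairsP
open import Data.List.Relation.Unary.Any using (here; there)
open import Data.List.Membership.Propositional using (_∈_; _∉_)
open import Data.List.Membership.Propositional.Properties
  using (∈-map⁺; ∈-map⁻; ∈-∃++; ∈-++⁺ˡ; ∈-++⁺ʳ; ∈-++⁻; ∈-filter⁺; ∈-filter⁻; ∈-upTo⁺; ∈-upTo⁻;
         ∈-cartesianProductWith⁺; ∈-cartesianProductWith⁻)
open import Data.List.Relation.Unary.Unique.Propositional.Properties
  using (Unique[x∷xs]⇒x∉xs; upTo⁺; filter⁺; map⁺)
open import Function.Bundles using (mk⇔; Equivalence)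

m*n>0 : ∀ {m n} → 0 < m → 0 < n → 0 < m * n
m*n>0 {suc m} {suc n} _ _ = s≤s z≤n

prime>1 : ∀ {p} → Prime p → 1 < p
prime>1 {p} pp = nonTrivial⇒n>1 p {{prime⇒nonTrivial pp}}

even-or-odd : ∀ n → Even n ⊎ Odd n
even-or-odd zero = inj₁ (0 , refl)
even-or-odd (suc n) with even-or-odd n
... | inj₁ (u , n≡2u) = inj₂ (u , cong suc n≡2u)
... | inj₂ (u , n≡1+2u) = inj₁ (suc u , trans (cong suc n≡1+2u) (sym (*-suc 2 u)))

2∤⇒odd : ∀ {w} → ¬ 2 ∣ w → Odd w
2∤⇒odd {w} 2∤w with even-or-odd w
... | inj₁ (u , w≡2u) = ⊥-elim (2∤w (divides u (trans w≡2u (*-comm 2 u))))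
... | inj₂ w-odd = w-odd

half : ∀ {n m} → n ≡ 2 * m → n / 2 ≡ m
half {m = m} refl = trans (cong (_/ 2) (*-comm 2 m)) (m*n/n≡m m 2)

increasing⇒injective : (f : ℕ → ℕ) → (∀ {a b} → a < b → f a < f b) → ∀ {a b} → f a ≡ f b → a ≡ b
increasing⇒injective f increasing {a} {b} fa≡fb with <-cmp a b
... | tri< a<b _ _ = ⊥-elim (<⇒≢ (increasing a<b) fa≡fb)
... | tri≈ _ a≡b _ = a≡b
... | tri> _ _ b<a = ⊥-elim (<⇒≢ (increasing b<a) (sym fa≡fb))

record PAdicSplit (p x : ℕ) : Set where
  constructor p-adic
  field
    exponent cofactor : ℕ
    x≡p^e*x' : x ≡ p ^ exponent * cofactor
    p∤cofactor : ¬ p ∣ cofactor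

p-adic-split : ∀ {p} → Prime p → ∀ x → 0 < x → PAdicSplit p x
p-adic-split {p} pp = <-rec _ split
  where
  split : ∀ x → (∀ {y} → y < x → 0 < y → PAdicSplit p y) → 0 < x → PAdicSplit p x
  split x rec x>0 with p ∣? x
  ... | no p∤x = p-adic 0 x (sym (*-identityˡ x)) p∤x
  ... | yes (divides q x≡q*p) with rec q<x q>0
    where
    q>0 : 0 < q
    q>0 = n≢0⇒n>0 (λ { refl → <⇒≢ x>0 (sym x≡q*p) })
    q<x : q < x
    q<x = subst (q <_) (sym x≡q*p) (m<m*n q p {{>-nonZero q>0}} (prime>1 pp))
  ... | p-adic e x' q≡ p∤x' = p-adic (suc e) x' x≡ p∤x'
    where
    x≡ : x ≡ p ^ suc e * x'
    x≡ = trans x≡q*p (trans (*-comm q p) (trans (cong (p *_) q≡) (sym (*-assoc p (p ^ e) x'))))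

split-unique : ∀ {p} → 1 < p → ∀ a b {x y} → p ^ a * x ≡ p ^ b * y → ¬ p ∣ x → ¬ p ∣ y → a ≡ b × x ≡ y
split-unique _ zero zero {x} {y} eq _ _ = refl , trans (sym (*-identityˡ x)) (trans eq (*-identityˡ y))
split-unique {p} _ zero (suc b) {x} {y} eq p∤x _ =
  ⊥-elim (p∤x (divides (p ^ b * y)
    (trans (sym (*-identityˡ x)) (trans eq (trans (*-assoc p (p ^ b) y) (*-comm p (p ^ b * y)))))))
split-unique {p} _ (suc a) zero {x} {y} eq _ p∤y =
  ⊥-elim (p∤y (divides (p ^ a * x)
    (trans (sym (*-identityˡ y)) (trans (sym eq) (trans (*-assoc p (p ^ a) x) (*-comm p (p ^ a * x)))))))
split-unique {p@(suc _)} p>1 (suc a) (suc b) {x} {y} eq p∤x p∤y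
  with split-unique p>1 a b (*-cancelˡ-≡ (p ^ a * x) (p ^ b * y) p
         (trans (sym (*-assoc p (p ^ a) x)) (trans eq (*-assoc p (p ^ b) y)))) p∤x p∤y
... | refl , x≡y = refl , x≡y

prime∣prime⇒≡ : ∀ {p q} → Prime p → Prime q → p ∣ q → p ≡ q
prime∣prime⇒≡ pp pq p∣q with prime⇒irreducible pq p∣q
... | inj₁ refl = ⊥-elim (<-irrefl refl (prime>1 pp))
... | inj₂ p≡q = p≡q

prime∣prime^⇒≡ : ∀ {p q} → Prime p → Prime q → ∀ s → p ∣ q ^ s → p ≡ q
prime∣prime^⇒≡ pp _ zero p∣1 = ⊥-elim (<-irrefl (sym (∣1⇒≡1 p∣1)) (prime>1 pp))
prime∣prime^⇒≡ {q = q} pp pq (suc s) p∣q^s+1 with euclidsLemma q (q ^ s) pp p∣q^s+1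
... | inj₁ p∣q = prime∣prime⇒≡ pp pq p∣q
... | inj₂ p∣q^s = prime∣prime^⇒≡ pp pq s p∣q^s

DistinctPrimes : List (ℕ × ℕ) → Set
DistinctPrimes fs = All (λ f → Prime (proj₁ f)) fs × Unique (map proj₁ fs)

prime∤primePowerProduct : ∀ {p} → Prime p → ∀ fs → All (λ f → Prime (proj₁ f)) fs →
                          p ∉ map proj₁ fs → ¬ p ∣ primePowerProduct fs
prime∤primePowerProduct pp [] _ _ p∣1 = <-irrefl (sym (∣1⇒≡1 p∣1)) (prime>1 pp)
prime∤primePowerProduct pp ((q , s) ∷ fs) (pq All.∷ pfs) p∉ p∣ with euclidsLemma (q ^ s) (primePowerProduct fs) pp p∣
... | inj₁ p∣q^s = p∉ (here (prime∣prime^⇒≡ pp pq s p∣q^s))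
... | inj₂ p∣rest = prime∤primePowerProduct pp fs pfs (λ p∈ → p∉ (there p∈)) p∣rest

head∤tail : ∀ {p s fs} → DistinctPrimes ((p , s) ∷ fs) → ¬ p ∣ primePowerProduct fs
head∤tail {fs = fs} (pp All.∷ pfs , distinct) =
  prime∤primePowerProduct pp fs pfs (Unique[x∷xs]⇒x∉xs distinct)

prime∣square⇒∣ : ∀ {p m} → Prime p → p ∣ m * m → p ∣ m
prime∣square⇒∣ {m = m} pp p∣m² = [ (λ p∣m → p∣m) , (λ p∣m → p∣m) ]′ (euclidsLemma m m pp p∣m²)

-- w² ∣ m² implies w ∣ m: the cofactors w' = w/g, m' = m/g of g = gcd w m are coprime,
-- and w' ∣ m'² then forces w' ∣ m', hence w' = 1 and w = g ∣ m.
square∣square⇒∣ : ∀ {w m} → 0 < w → w * w ∣ m * m → w ∣ m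
square∣square⇒∣ {w} {m} w>0 w²∣m² = subst (_∣ m) (sym w≡g) (gcd[m,n]∣n w m)
  where
  g : ℕ
  g = gcd w m
  instance
    g≢0 : NonZero g
    g≢0 = ≢-nonZero (gcd[m,n]≢0 w m (inj₁ (λ { refl → <-irrefl refl w>0 })))
    g²≢0 : NonZero (g * g)
    g²≢0 = m*n≢0 g g
  w' m' : ℕ
  w' = w / g
  m' = m / g
  w≡w'g : w ≡ w' * g
  w≡w'g = sym (m/n*n≡m (gcd[m,n]∣m w m))
  m≡m'g : m ≡ m' * g
  m≡m'g = sym (m/n*n≡m (gcd[m,n]∣n w m))
  regroup : ∀ a b → (a * b) * (a * b) ≡ (b * b) * (a * a)
  regroup = solve-∀
  w'²∣m'² : w' * w' ∣ m' * m'
  w'²∣m'² = *-cancelˡ-∣ (g * g) (subst₂ _∣_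
    (trans (cong (λ z → z * z) w≡w'g) (regroup w' g))
    (trans (cong (λ z → z * z) m≡m'g) (regroup m' g)) w²∣m²)
  coprime : Coprime w' m'
  coprime = coprime-/gcd w m
  w'≡1 : w' ≡ 1
  w'≡1 = coprime (∣-refl , coprime-divisor coprime (∣-trans (m∣m*n w') w'²∣m'²))
  w≡g : w ≡ g
  w≡g = trans w≡w'g (trans (cong (_* g) w'≡1) (*-identityˡ g))

square-difference : ∀ {n k l} → k * k ≡ n + l * l → ∃[ r ] (k ≡ l + r × n ≡ r * (2 * l + r))
square-difference {n} {k} {l} k²≡n+l² = k ∸ l , k≡l+r , n≡r[2l+r]
  where
  l≤k : l ≤ k
  l≤k = ≮⇒≥ (λ k<l → <⇒≱ (*-mono-< k<l k<l) (subst (l * l ≤_) (sym k²≡n+l²) (m≤n+m (l * l) n)))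
  k≡l+r : k ≡ l + (k ∸ l)
  k≡l+r = sym (m+[n∸m]≡n l≤k)
  expand : ∀ l r → (l + r) * (l + r) ≡ r * (2 * l + r) + l * l
  expand = solve-∀
  n≡r[2l+r] : n ≡ (k ∸ l) * (2 * l + (k ∸ l))
  n≡r[2l+r] = +-cancelʳ-≡ (l * l) n _
    (trans (sym k²≡n+l²) (trans (cong (λ z → z * z) k≡l+r) (expand l (k ∸ l))))

-- For even n the difference r = k − l is even too (an odd r makes r(2l + r) odd), so
-- writing r = 2u every representation has the shape k = 2u + l, n = 4u(u + l).
even-rep-structure : ∀ {n k l} → Even n → Rep n k l →
                     ∃[ u ] (k ≡ u + (u + l) × n ≡ 4 * (u * (u + l)))
even-rep-structure {n} {k} {l} (t , n≡2t) (_ , _ , k²≡n+l²) = from-difference (square-difference k²≡n+l²)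
  where
  open ≡-Reasoning
  k-even : ∀ u l → l + 2 * u ≡ u + (u + l)
  k-even = solve-∀
  n-even : ∀ u l → 2 * u * (2 * l + 2 * u) ≡ 4 * (u * (u + l))
  n-even = solve-∀
  n-odd : ∀ u l → (1 + 2 * u) * (2 * l + (1 + 2 * u)) ≡ 1 + 2 * (l + 2 * (u * l) + 2 * u * u + 2 * u)
  n-odd = solve-∀
  from-difference : ∃[ r ] (k ≡ l + r × n ≡ r * (2 * l + r)) → ∃[ u ] (k ≡ u + (u + l) × n ≡ 4 * (u * (u + l)))
  from-difference (r , k≡l+r , n≡r[2l+r]) with even-or-odd r
  ... | inj₁ (u , r≡2u) = u ,
    trans k≡l+r (trans (cong (l +_) r≡2u) (k-even u l)) ,
    trans n≡r[2l+r] (trans (cong (λ z → z * (2 * l + z)) r≡2u) (n-even u l))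
  ... | inj₂ (u , r≡1+2u) = ⊥-elim (even≢odd t (l + 2 * (u * l) + 2 * u * u + 2 * u) (begin
    2 * t                          ≡⟨ sym n≡2t ⟩
    n                              ≡⟨ n≡r[2l+r] ⟩
    r * (2 * l + r)                ≡⟨ cong (λ z → z * (2 * l + z)) r≡1+2u ⟩
    (1 + 2 * u) * (2 * l + (1 + 2 * u)) ≡⟨ n-odd u l ⟩
    1 + 2 * (l + 2 * (u * l) + 2 * u * u + 2 * u) ∎))

rep-from-factors : ∀ u t → 0 < t → Rep (4 * (u * (u + t))) (u + (u + t)) t
rep-from-factors u t t>0 = ≤-trans t>0 (≤-trans (m≤n+m t u) (m≤n+m (u + t) u)) , t>0 , expand u t
  where
  expand : ∀ u t → (u + (u + t)) * (u + (u + t)) ≡ 4 * (u * (u + t)) + t * t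
  expand = solve-∀

param-from-factors : ∀ u t → Param (4 * (u * (u + t))) (2 * (u * u)) (u + (u + t)) t
param-from-factors u t = 2 * u , r² u , r*k u t , r*l u t
  where
  r² : ∀ u → 2 * u * (2 * u) ≡ 2 * (2 * (u * u))
  r² = solve-∀
  r*k : ∀ u t → 2 * (2 * u) * (u + (u + t)) ≡ 4 * (u * (u + t)) + 2 * (2 * (u * u))
  r*k = solve-∀
  r*l : ∀ u t → 2 * (2 * u) * t + 2 * (2 * (u * u)) ≡ 4 * (u * (u + t))
  r*l = solve-∀

rep-from-pair : ∀ {n u v} → n ≡ 4 * (u * v) → u < v →
                Rep n (u + v) (v ∸ u) × Param n (2 * (u * u)) (u + v) (v ∸ u)
rep-from-pair {u = u} {v} refl u<v =
  subst (λ w → Rep (4 * (u * w)) (u + w) t) v≡u+t (rep-from-factors u t (m<n⇒0<n∸m u<v)) ,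
  subst (λ w → Param (4 * (u * w)) (2 * (u * u)) (u + w) t) v≡u+t (param-from-factors u t)
  where
  t : ℕ
  t = v ∸ u
  v≡u+t : u + t ≡ v
  v≡u+t = m+[n∸m]≡n (<⇒≤ u<v)

twice-square-shape : ∀ a w → 2 * ((2 ^ a * w) * (2 ^ a * w)) ≡ 2 ^ (2 * a + 1) * (w * w)
twice-square-shape a w = begin
  2 * ((2 ^ a * w) * (2 ^ a * w))     ≡⟨ regroup (2 ^ a) w ⟩
  2 * (2 ^ a * 2 ^ a) * (w * w)       ≡⟨ cong (λ z → 2 * z * (w * w)) (sym (^-distribˡ-+-* 2 a a)) ⟩
  2 ^ suc (a + a) * (w * w)           ≡⟨ cong (λ z → 2 ^ z * (w * w)) (exponent a) ⟩
  2 ^ (2 * a + 1) * (w * w)           ∎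
  where
  open ≡-Reasoning
  regroup : ∀ x w → 2 * ((x * w) * (x * w)) ≡ 2 * (x * x) * (w * w)
  regroup = solve-∀
  exponent : ∀ a → suc (a + a) ≡ 2 * a + 1
  exponent = solve-∀

-- An admissible d yields a divisor pair h < c of n/4 with d = 2h²: writing d = 2h²,
-- 2h² ∣ (n/2)² gives h ∣ n/2 with an even cofactor 2c, and 2d < n gives h < c.
admissible⇒pair : ∀ {n m d} → n ≡ 2 * m → Admissible n d →
                  ∃[ h ] ∃[ c ] (n ≡ 4 * (h * c) × h < c × d ≡ 2 * (h * h))
admissible⇒pair {n} {m} {d} n≡2m (d∣[n/2]² , 2d<n , a , w , w-odd , d≡) = h , c , n≡4hc , h<c , d≡2h²
  where
  h : ℕ
  h = 2 ^ a * w
  d≡2h² : d ≡ 2 * (h * h)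
  d≡2h² = trans d≡ (sym (twice-square-shape a w))
  h>0 : 0 < h
  h>0 = m*n>0 (m^n>0 2 a) (subst (0 <_) (sym (proj₂ w-odd)) (s≤s z≤n))
  instance
    h²≢0 : NonZero (h * h)
    h²≢0 = >-nonZero (m*n>0 h>0 h>0)
  2h²∣m² : 2 * (h * h) ∣ m * m
  2h²∣m² = subst₂ (λ x y → x ∣ y * y) d≡2h² (half {n} {m} n≡2m) d∣[n/2]²
  h∣m : h ∣ m
  h∣m = square∣square⇒∣ h>0 (∣-trans (n∣m*n 2) 2h²∣m²)
  c₁ : ℕ
  c₁ = quotient h∣m
  m≡c₁h : m ≡ c₁ * h
  m≡c₁h = m∣n⇒n≡quotient*m h∣m
  regroup : ∀ c h → c * h * (c * h) ≡ h * h * (c * c)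
  regroup = solve-∀
  2∣c₁² : 2 ∣ c₁ * c₁
  2∣c₁² = *-cancelˡ-∣ (h * h)
    (subst₂ _∣_ (*-comm 2 (h * h)) (trans (cong (λ z → z * z) m≡c₁h) (regroup c₁ h)) 2h²∣m²)
  2∣c₁ : 2 ∣ c₁
  2∣c₁ = prime∣square⇒∣ prime[2] 2∣c₁²
  c : ℕ
  c = quotient 2∣c₁
  four : ∀ c h → 2 * (c * 2 * h) ≡ 4 * (h * c)
  four = solve-∀
  n≡4hc : n ≡ 4 * (h * c)
  n≡4hc = trans n≡2m (trans (cong (2 *_) (trans m≡c₁h (cong (_* h) (m∣n⇒n≡quotient*m 2∣c₁))))
            (four c h))
  four² : ∀ h → 2 * (2 * (h * h)) ≡ 4 * (h * h)
  four² = solve-∀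
  h<c : h < c
  h<c = *-cancelˡ-< h h c (*-cancelˡ-< 4 (h * h) (h * c)
          (subst₂ _<_ (trans (cong (2 *_) d≡2h²) (four² h)) n≡4hc 2d<n))

-- A divisor pair u < v of n/4 conversely gives the admissible parameter d = 2u²
-- (u = 2^a w with w odd by splitting off the power of 2).
pair⇒admissible : ∀ {n u v} → n ≡ 4 * (u * v) → 0 < u → u < v → Admissible n (2 * (u * u))
pair⇒admissible {n} {u} {v} n≡4uv u>0 u<v = d∣[n/2]² , 2d<n , a , w , 2∤⇒odd 2∤w , shape
  where
  open PAdicSplit (p-adic-split prime[2] u u>0)
    renaming (exponent to a; cofactor to w; x≡p^e*x' to u≡2^aw; p∤cofactor to 2∤w)
  halves : ∀ u v → 4 * (u * v) ≡ 2 * (2 * (u * v))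
  halves = solve-∀
  square-split : ∀ u v → 2 * (u * v) * (2 * (u * v)) ≡ 2 * (u * u) * (2 * (v * v))
  square-split = solve-∀
  d∣[n/2]² : 2 * (u * u) ∣ (n / 2) * (n / 2)
  d∣[n/2]² = subst (λ x → 2 * (u * u) ∣ x * x) (sym (half {n} {2 * (u * v)} (trans n≡4uv (halves u v))))
               (subst (2 * (u * u) ∣_) (sym (square-split u v)) (m∣m*n (2 * (v * v))))
  four² : ∀ u → 2 * (2 * (u * u)) ≡ 4 * (u * u)
  four² = solve-∀
  2d<n : 2 * (2 * (u * u)) < n
  2d<n = subst₂ _<_ (sym (four² u)) (sym n≡4uv) (*-monoʳ-< 4 (*-monoʳ-< u {{>-nonZero u>0}} u<v))
  shape : 2 * (u * u) ≡ 2 ^ (2 * a + 1) * (w * w)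
  shape = trans (cong (λ z → 2 * (z * z)) u≡2^aw) (twice-square-shape a w)

admissible⇒rep : ∀ {n m d} → n ≡ 2 * m → Admissible n d → ∃[ k ] ∃[ l ] (Param n d k l × Rep n k l)
admissible⇒rep {n} {m} {d} n≡2m admissible = from-pair (admissible⇒pair {n} {m} {d} n≡2m admissible)
  where
  from-pair : ∃[ h ] ∃[ c ] (n ≡ 4 * (h * c) × h < c × d ≡ 2 * (h * h)) → ∃[ k ] ∃[ l ] (Param n d k l × Rep n k l)
  from-pair (h , c , n≡4hc , h<c , d≡2h²) =
    h + c , c ∸ h , subst (λ d → Param n d (h + c) (c ∸ h)) (sym d≡2h²) (proj₂ rep×param) , proj₁ rep×param
    where
    rep×param : Rep n (h + c) (c ∸ h) × Param n (2 * (h * h)) (h + c) (c ∸ h)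
    rep×param = rep-from-pair {n} {h} {c} n≡4hc h<c

rep⇒admissible : ∀ {n k l} → 0 < n → Even n → Rep n k l → ∃[ d ] (Admissible n d × Param n d k l)
rep⇒admissible {n} {k} {l} n>0 n-even rep@(_ , l>0 , _) with even-rep-structure n-even rep
... | u , k≡ , n≡ = 2 * (u * u) , pair⇒admissible n≡ u>0 (m<m+n u l>0) ,
                    subst₂ (λ n k → Param n (2 * (u * u)) k l) (sym n≡) (sym k≡) (param-from-factors u l)
  where
  u>0 : 0 < u
  u>0 = n≢0⇒n>0 (λ { refl → <⇒≢ n>0 (sym n≡) })

admissible⇒positive : ∀ {n d} → Admissible n d → 0 < d
admissible⇒positive (_ , _ , a , w , (t , refl) , refl) = m*n>0 (m^n>0 2 (2 * a + 1)) (s≤s z≤n)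

-- The parameter of a representation is forced to be r = k − l: from 2rk = n + 2d,
-- 2rl + 2d = n and r² = 2d we get 2r·k = 2r·(l + r), and r > 0 as d > 0.
param-root : ∀ {n d k l} → 0 < d → (param : Param n d k l) → k ≡ l + proj₁ param
param-root {n} {d} {k} {l} d>0 (r , r²≡2d , 2rk≡n+2d , 2rl+2d≡n) =
  *-cancelˡ-≡ k (l + r) (2 * r) {{>-nonZero (m*n>0 {2} (s≤s z≤n) r>0)}} (begin
    2 * r * k                   ≡⟨ 2rk≡n+2d ⟩
    n + 2 * d                   ≡⟨ cong (_+ 2 * d) (sym 2rl+2d≡n) ⟩
    2 * r * l + 2 * d + 2 * d   ≡⟨ regroup (2 * r * l) d ⟩
    2 * r * l + (2 * d + 2 * d) ≡⟨ cong (λ z → 2 * r * l + (z + z)) (sym r²≡2d) ⟩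
    2 * r * l + (r * r + r * r) ≡⟨ factor r l ⟩
    2 * r * (l + r)             ∎)
  where
  open ≡-Reasoning
  r>0 : 0 < r
  r>0 = n≢0⇒n>0 (λ { refl → <⇒≢ (m*n>0 {2} (s≤s z≤n) d>0) r²≡2d })
  regroup : ∀ x d → x + 2 * d + 2 * d ≡ x + (2 * d + 2 * d)
  regroup = solve-∀
  factor : ∀ r l → 2 * r * l + (r * r + r * r) ≡ 2 * r * (l + r)
  factor = solve-∀

param-unique : ∀ {n d d' k l} → 0 < d → 0 < d' → Param n d k l → Param n d' k l → d ≡ d'
param-unique {l = l} d>0 d'>0 param@(r , r²≡2d , _) param'@(r' , r'²≡2d' , _) =
  *-cancelˡ-≡ _ _ 2 (trans (sym r²≡2d) (trans (cong (λ z → z * z) r≡r') r'²≡2d'))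
  where
  r≡r' : r ≡ r'
  r≡r' = +-cancelˡ-≡ l r r' (trans (sym (param-root d>0 param)) (param-root d'>0 param'))

rep⇒4∣ : ∀ {n k l} → Even n → Rep n k l → 4 ∣ n
rep⇒4∣ {l = l} n-even rep with even-rep-structure n-even rep
... | u , _ , n≡ = divides (u * (u + l)) (trans n≡ (*-comm 4 (u * (u + l))))

no-rep-mod4 : ∀ {n} → n % 4 ≡ 2 → ∀ k l → ¬ Rep n k l
no-rep-mod4 {n} n%4≡2 k l rep = 0≢2 (trans (sym (n∣m⇒m%n≡0 n 4 (rep⇒4∣ n-even rep))) n%4≡2)
  where
  0≢2 : 0 ≢ 2
  0≢2 ()
  regroup : ∀ q → 2 + q * 4 ≡ 2 * (1 + 2 * q)
  regroup = solve-∀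
  n-even : Even n
  n-even = 1 + 2 * (n / 4) , trans (m≡m%n+[m/n]*n n 4) (trans (cong (_+ (n / 4) * 4) n%4≡2) (regroup (n / 4)))

map-unique : ∀ {A B : Set} (f : A → B) (xs : List A) →
             (∀ {x y} → x ∈ xs → y ∈ xs → f x ≡ f y → x ≡ y) → Unique xs → Unique (map f xs)
map-unique f [] _ _ = []
map-unique f (x ∷ xs) injective unique@(_ ∷ unique-xs) =
  All.tabulate fx≢ ∷ map-unique f xs (λ x∈ y∈ → injective (there x∈) (there y∈)) unique-xs
  where
  fx≢ : ∀ {z} → z ∈ map f xs → f x ≢ z
  fx≢ z∈ fx≡z with ∈-map⁻ f z∈
  ... | y , y∈ , z≡fy = Unique[x∷xs]⇒x∉xs unique
                          (subst (_∈ xs) (sym (injective (here refl) (there y∈) (trans fx≡z z≡fy))) y∈)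

cartesianProductWith-unique : ∀ {A B C : Set} (f : A → B → C) (xs : List A) (ys : List B) →
  (∀ {a a' b b'} → a ∈ xs → a' ∈ xs → b ∈ ys → b' ∈ ys → f a b ≡ f a' b' → a ≡ a' × b ≡ b') →
  Unique xs → Unique ys → Unique (cartesianProductWith f xs ys)
cartesianProductWith-unique f [] ys _ _ _ = []
cartesianProductWith-unique f (x ∷ xs) ys injective unique-x∷xs@(_ ∷ unique-xs) unique-ys =
  AllPairsP.++⁺ row rest (All.tabulate λ c∈row → All.tabulate λ c'∈rest → disjoint c∈row c'∈rest)
  where
  row : Unique (map (f x) ys)
  row = map-unique (f x) ys (λ b∈ b'∈ e → proj₂ (injective (here refl) (here refl) b∈ b'∈ e)) unique-ys
  rest : Unique (cartesianProductWith f xs ys)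
  rest = cartesianProductWith-unique f xs ys (λ a∈ a'∈ → injective (there a∈) (there a'∈)) unique-xs unique-ys
  disjoint : ∀ {c c'} → c ∈ map (f x) ys → c' ∈ cartesianProductWith f xs ys → c ≢ c'
  disjoint c∈row c'∈rest c≡c' with ∈-map⁻ (f x) c∈row | ∈-cartesianProductWith⁻ f xs ys c'∈rest
  ... | b , b∈ , c≡fxb | a , b' , a∈ , b'∈ , c'≡fab' =
    Unique[x∷xs]⇒x∉xs unique-x∷xs
      (subst (_∈ xs) (sym (proj₁ (injective (here refl) (there a∈) b∈ b'∈ (trans (sym c≡fxb) (trans c≡c' c'≡fab'))))) a∈)

length-cartesianProductWith : ∀ {A B C : Set} (f : A → B → C) (xs : List A) (ys : List B) →
                              length (cartesianProductWith f xs ys) ≡ length xs * length ys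
length-cartesianProductWith f [] ys = refl
length-cartesianProductWith f (x ∷ xs) ys =
  trans (length-++ (map (f x) ys)) (cong₂ _+_ (length-map (f x) ys) (length-cartesianProductWith f xs ys))

unique⊆⇒length≤ : ∀ {A : Set} (xs ys : List A) → Unique xs → (∀ {x} → x ∈ xs → x ∈ ys) → length xs ≤ length ys
unique⊆⇒length≤ [] ys _ _ = z≤n
unique⊆⇒length≤ (x ∷ xs) ys unique@(_ ∷ unique-xs) xs⊆ys with ∈-∃++ (xs⊆ys (here refl))
... | as , bs , refl = subst (suc (length xs) ≤_) (sym length-as++x∷bs)
                         (s≤s (unique⊆⇒length≤ xs (as ++ bs) unique-xs xs⊆as++bs))
  where
  length-as++x∷bs : length (as ++ x ∷ bs) ≡ suc (length (as ++ bs))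
  length-as++x∷bs = trans (length-++ as) (trans (+-suc (length as) (length bs)) (cong suc (sym (length-++ as))))
  xs⊆as++bs : ∀ {y} → y ∈ xs → y ∈ as ++ bs
  xs⊆as++bs {y} y∈ with ∈-++⁻ as (xs⊆ys (there y∈))
  ... | inj₁ y∈as = ∈-++⁺ˡ y∈as
  ... | inj₂ (here refl) = ⊥-elim (Unique[x∷xs]⇒x∉xs unique y∈)
  ... | inj₂ (there y∈bs) = ∈-++⁺ʳ as y∈bs

same-members⇒same-length : ∀ {A : Set} (xs ys : List A) → Unique xs → Unique ys →
  (∀ {x} → x ∈ xs → x ∈ ys) → (∀ {x} → x ∈ ys → x ∈ xs) → length xs ≡ length ys
same-members⇒same-length xs ys unique-xs unique-ys xs⊆ys ys⊆xs =
  ≤-antisym (unique⊆⇒length≤ xs ys unique-xs xs⊆ys) (unique⊆⇒length≤ ys xs unique-ys ys⊆xs)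

below? : (x : ℕ × ℕ) → Dec (proj₁ x < proj₂ x)
below? x = proj₁ x <? proj₂ x

diagonal? : (x : ℕ × ℕ) → Dec (proj₁ x ≡ proj₂ x)
diagonal? x = proj₁ x ≟ proj₂ x

above? : (x : ℕ × ℕ) → Dec (proj₂ x < proj₁ x)
above? x = proj₂ x <? proj₁ x

trichotomy-length : ∀ xs → length (filter below? xs) + length (filter diagonal? xs) + length (filter above? xs)
                           ≡ length xs
trichotomy-length [] = refl
trichotomy-length (x@(u , v) ∷ xs) with <-cmp u v
... | tri< u<v u≢v v≮u
  rewrite filter-accept below? {x} {xs} u<v | filter-reject diagonal? {x} {xs} u≢v | filter-reject above? {x} {xs} v≮u
  = cong suc (trichotomy-length xs)
... | tri≈ u≮v u≡v v≮u
  rewrite filter-reject below? {x} {xs} u≮v | filter-accept diagonal? {x} {xs} u≡v | filter-reject above? {x} {xs} v≮u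
  = trans (cong (_+ length (filter above? xs)) (+-suc (length (filter below? xs)) _)) (cong suc (trichotomy-length xs))
... | tri> u≮v u≢v v<u
  rewrite filter-reject below? {x} {xs} u≮v | filter-reject diagonal? {x} {xs} u≢v | filter-accept above? {x} {xs} v<u
  = trans (+-suc (length (filter below? xs) + length (filter diagonal? xs)) _) (cong suc (trichotomy-length xs))

prime∤* : ∀ {p x y} → Prime p → ¬ p ∣ x → ¬ p ∣ y → ¬ p ∣ x * y
prime∤* {x = x} {y} pp p∤x p∤y p∣xy = [ p∤x , p∤y ]′ (euclidsLemma x y pp p∣xy)

record ProductSplit (p s N u v : ℕ) : Set where
  field
    e u' v' : ℕ
    e≤s : e ≤ s
    u≡p^eu' : u ≡ p ^ e * u'
    v≡p^[s-e]v' : v ≡ p ^ (s ∸ e) * v'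
    u'v'≡N : u' * v' ≡ N
    p∤u' : ¬ p ∣ u'
    p∤v' : ¬ p ∣ v'

split-product : ∀ {p} → Prime p → ∀ s {N u v} → ¬ p ∣ N → u * v ≡ p ^ s * N → ProductSplit p s N u v
split-product {p} pp s {N} {u} {v} p∤N uv≡p^sN = record
  { e = a ; u' = u' ; v' = v' ; e≤s = a≤s ; u≡p^eu' = u≡p^au' ; v≡p^[s-e]v' = v≡p^[s-a]v'
  ; u'v'≡N = u'v'≡N ; p∤u' = p∤u' ; p∤v' = p∤v' }
  where
  instance
    p≢0 : NonZero p
    p≢0 = prime⇒nonZero pp
  p^sN>0 : 0 < p ^ s * N
  p^sN>0 = m*n>0 (m^n>0 p s) (n≢0⇒n>0 (λ { refl → p∤N (p ∣0) }))
  u>0 : 0 < u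
  u>0 = n≢0⇒n>0 (λ { refl → <⇒≢ p^sN>0 uv≡p^sN })
  v>0 : 0 < v
  v>0 = n≢0⇒n>0 (λ { refl → <⇒≢ p^sN>0 (trans (sym (*-zeroʳ u)) uv≡p^sN) })
  open PAdicSplit (p-adic-split pp u u>0)
    renaming (exponent to a; cofactor to u'; x≡p^e*x' to u≡p^au'; p∤cofactor to p∤u')
  open PAdicSplit (p-adic-split pp v v>0)
    renaming (exponent to b; cofactor to v'; x≡p^e*x' to v≡p^bv'; p∤cofactor to p∤v')
  regroup : ∀ x u y v → (x * u) * (y * v) ≡ (x * y) * (u * v)
  regroup = solve-∀
  p^[a+b]u'v'≡p^sN : p ^ (a + b) * (u' * v') ≡ p ^ s * N
  p^[a+b]u'v'≡p^sN = begin
    p ^ (a + b) * (u' * v')       ≡⟨ cong (_* (u' * v')) (^-distribˡ-+-* p a b) ⟩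
    (p ^ a * p ^ b) * (u' * v')   ≡⟨ sym (regroup (p ^ a) u' (p ^ b) v') ⟩
    (p ^ a * u') * (p ^ b * v')   ≡⟨ sym (cong₂ _*_ u≡p^au' v≡p^bv') ⟩
    u * v                         ≡⟨ uv≡p^sN ⟩
    p ^ s * N                     ∎
    where open ≡-Reasoning
  exponents : a + b ≡ s × u' * v' ≡ N
  exponents = split-unique (prime>1 pp) (a + b) s p^[a+b]u'v'≡p^sN (prime∤* pp p∤u' p∤v') p∤N
  u'v'≡N : u' * v' ≡ N
  u'v'≡N = proj₂ exponents
  a≤s : a ≤ s
  a≤s = subst (a ≤_) (proj₁ exponents) (m≤m+n a b)
  v≡p^[s-a]v' : v ≡ p ^ (s ∸ a) * v'
  v≡p^[s-a]v' = trans v≡p^bv' (cong (λ z → p ^ z * v')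
                  (sym (trans (cong (_∸ a) (sym (proj₁ exponents))) (m+n∸m≡n a b))))

shiftPair : ℕ → ℕ → ℕ → ℕ × ℕ → ℕ × ℕ
shiftPair p s e (u , v) = p ^ e * u , p ^ (s ∸ e) * v

divisorPairs : List (ℕ × ℕ) → List (ℕ × ℕ)
divisorPairs [] = [ (1 , 1) ]
divisorPairs ((p , s) ∷ fs) = cartesianProductWith (shiftPair p s) (upTo (suc s)) (divisorPairs fs)

divisorPairs-length : ∀ fs → length (divisorPairs fs) ≡ exponentFactor fs
divisorPairs-length [] = refl
divisorPairs-length ((p , s) ∷ fs) =
  trans (length-cartesianProductWith (shiftPair p s) (upTo (suc s)) (divisorPairs fs))
        (cong₂ _*_ (length-upTo (suc s)) (divisorPairs-length fs))

divisorPairs-sound : ∀ fs {u v} → (u , v) ∈ divisorPairs fs → u * v ≡ primePowerProduct fs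
divisorPairs-sound [] (here refl) = refl
divisorPairs-sound ((p , s) ∷ fs) uv∈ with ∈-cartesianProductWith⁻ (shiftPair p s) (upTo (suc s)) (divisorPairs fs) uv∈
... | e , (u , v) , e∈ , uv∈fs , refl = begin
  (p ^ e * u) * (p ^ (s ∸ e) * v)   ≡⟨ regroup (p ^ e) u (p ^ (s ∸ e)) v ⟩
  (p ^ e * p ^ (s ∸ e)) * (u * v)   ≡⟨ cong₂ _*_ p^e*p^[s-e]≡p^s (divisorPairs-sound fs uv∈fs) ⟩
  p ^ s * primePowerProduct fs      ∎
  where
  open ≡-Reasoning
  regroup : ∀ x u y v → (x * u) * (y * v) ≡ (x * y) * (u * v)
  regroup = solve-∀
  p^e*p^[s-e]≡p^s : p ^ e * p ^ (s ∸ e) ≡ p ^ s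
  p^e*p^[s-e]≡p^s = trans (sym (^-distribˡ-+-* p e (s ∸ e))) (cong (p ^_) (m+[n∸m]≡n (s≤s⁻¹ (∈-upTo⁻ e∈))))

divisorPairs-unique : ∀ fs → DistinctPrimes fs → Unique (divisorPairs fs)
divisorPairs-unique [] _ = All.[] ∷ []
divisorPairs-unique ((p , s) ∷ fs) distinct@(pp All.∷ pfs , _ ∷ unique-fs) =
  cartesianProductWith-unique (shiftPair p s) (upTo (suc s)) (divisorPairs fs) injective
    (upTo⁺ (suc s)) (divisorPairs-unique fs (pfs , unique-fs))
  where
  p∤first : ∀ {u v} → (u , v) ∈ divisorPairs fs → ¬ p ∣ u
  p∤first {u} {v} uv∈ p∣u =
    head∤tail distinct (∣-trans p∣u (divides v (trans (sym (divisorPairs-sound fs uv∈)) (*-comm u v))))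
  injective : ∀ {e e' uv u'v'} → e ∈ upTo (suc s) → e' ∈ upTo (suc s) → uv ∈ divisorPairs fs →
              u'v' ∈ divisorPairs fs → shiftPair p s e uv ≡ shiftPair p s e' u'v' → e ≡ e' × uv ≡ u'v'
  injective {e} {e'} {u , v} {u' , v'} _ _ uv∈ u'v'∈ shifted≡
    with split-unique (prime>1 pp) e e' (cong proj₁ shifted≡) (p∤first uv∈) (p∤first u'v'∈)
  ... | refl , refl = refl , cong (u ,_)
    (*-cancelˡ-≡ v v' (p ^ (s ∸ e)) {{m^n≢0 p (s ∸ e) {{prime⇒nonZero pp}}}} (cong proj₂ shifted≡))

divisorPairs-complete : ∀ fs → DistinctPrimes fs → ∀ {u v} → u * v ≡ primePowerProduct fs → (u , v) ∈ divisorPairs fs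
divisorPairs-complete [] _ {u} {v} uv≡1 with m*n≡1⇒m≡1 u v uv≡1 | m*n≡1⇒n≡1 u v uv≡1
... | refl | refl = here refl
divisorPairs-complete ((p , s) ∷ fs) distinct@(pp All.∷ pfs , _ ∷ unique-fs) {u} {v} uv≡ =
  subst (_∈ divisorPairs ((p , s) ∷ fs)) (sym (cong₂ _,_ u≡p^eu' v≡p^[s-e]v'))
    (∈-cartesianProductWith⁺ (shiftPair p s) (∈-upTo⁺ (s≤s e≤s)) (divisorPairs-complete fs (pfs , unique-fs) u'v'≡N))
  where open ProductSplit (split-product pp s {primePowerProduct fs} {u} {v} (head∤tail distinct) uv≡)

-- ∏ p^s is a perfect square iff all exponents s are even: in m² = p^s N both factors of
-- m·m split off the same power p^e, so s = 2e and N is again a square.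
square⇒even-exponents : ∀ fs → DistinctPrimes fs → IsSquare (primePowerProduct fs) → All (λ f → Even (proj₂ f)) fs
square⇒even-exponents [] _ _ = All.[]
square⇒even-exponents ((p , s) ∷ fs) distinct@(pp All.∷ pfs , _ ∷ unique-fs) (m , m²≡) =
  (e , s≡2e) All.∷ square⇒even-exponents fs (pfs , unique-fs) (u' , trans (cong (u' *_) u'≡v') u'v'≡N)
  where
  open ProductSplit (split-product pp s {primePowerProduct fs} {m} {m} (head∤tail distinct) m²≡)
  same-split : e ≡ s ∸ e × u' ≡ v'
  same-split = split-unique (prime>1 pp) e (s ∸ e) (trans (sym u≡p^eu') v≡p^[s-e]v') p∤u' p∤v'
  u'≡v' : u' ≡ v'
  u'≡v' = proj₂ same-split
  s≡2e : s ≡ 2 * e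
  s≡2e = trans (sym (m+[n∸m]≡n e≤s)) (trans (cong (e +_) (sym (proj₁ same-split))) (cong (e +_) (sym (+-identityʳ e))))

even-exponents⇒square : ∀ fs → All (λ f → Even (proj₂ f)) fs → IsSquare (primePowerProduct fs)
even-exponents⇒square [] _ = 1 , refl
even-exponents⇒square ((p , s) ∷ fs) ((t , refl) All.∷ evens) with even-exponents⇒square fs evens
... | r , r²≡N = p ^ t * r , (begin
  (p ^ t * r) * (p ^ t * r)     ≡⟨ regroup (p ^ t) r ⟩
  (p ^ t * p ^ t) * (r * r)     ≡⟨ cong₂ _*_ (sym (^-distribˡ-+-* p t t)) r²≡N ⟩
  p ^ (t + t) * primePowerProduct fs ≡⟨ cong (λ z → p ^ (t + z) * primePowerProduct fs) (sym (+-identityʳ t)) ⟩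
  p ^ (2 * t) * primePowerProduct fs ∎)
  where
  open ≡-Reasoning
  regroup : ∀ x r → (x * r) * (x * r) ≡ (x * x) * (r * r)
  regroup = solve-∀

Representations : ℕ → ℕ × ℕ → Set
Representations n kl = Rep n (proj₁ kl) (proj₂ kl)

-- The divisor pairs (u , v) of M with
-- u < v correspond bijectively to the representations via (u , v) ↦ (u + v , v − u); the
-- pairs with u > v are their mirror images, and the only possible diagonal pair is
-- (√M , √M). Hence 2·#representations + [n is a square] = #divisor pairs = ∏ (s + 1).
module RepresentationCount (fs : List (ℕ × ℕ)) (distinct : DistinctPrimes fs)
                           (n : ℕ) (n≡4M : n ≡ 4 * primePowerProduct fs) where

  private
    M : ℕ
    M = primePowerProduct fs
    pairs : List (ℕ × ℕ)
    pairs = divisorPairs fs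
    below diagonal above : List (ℕ × ℕ)
    below = filter below? pairs
    diagonal = filter diagonal? pairs
    above = filter above? pairs

    unique-pairs : Unique pairs
    unique-pairs = divisorPairs-unique fs distinct

    pair-product : ∀ {u v} → (u , v) ∈ pairs → u * v ≡ M
    pair-product = divisorPairs-sound fs

    pair-complete : ∀ {u v} → u * v ≡ M → (u , v) ∈ pairs
    pair-complete = divisorPairs-complete fs distinct

    toRep : ℕ × ℕ → ℕ × ℕ
    toRep (u , v) = u + v , v ∸ u

    reps : List (ℕ × ℕ)
    reps = map toRep below

    -- (u + v , v − u) determines u < v: v + v = (u + v) + (v − u), then u = (u + v) − v.
    toRep-injective : ∀ {x y} → x ∈ below → y ∈ below → toRep x ≡ toRep y → x ≡ y
    toRep-injective {u , v} {u' , v'} x∈ y∈ toRep≡ = cong₂ _,_ u≡u' v≡v'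
      where
      double : ∀ {u v} → (u , v) ∈ below → v + v ≡ (u + v) + (v ∸ u)
      double {u} {v} x∈ = begin
        v + v               ≡⟨ cong (v +_) (sym (m+[n∸m]≡n (<⇒≤ (proj₂ (∈-filter⁻ below? {xs = pairs} x∈))))) ⟩
        v + (u + (v ∸ u))   ≡⟨ sym (+-assoc v u (v ∸ u)) ⟩
        v + u + (v ∸ u)     ≡⟨ cong (_+ (v ∸ u)) (+-comm v u) ⟩
        u + v + (v ∸ u)     ∎
        where open ≡-Reasoning
      v≡v' : v ≡ v'
      v≡v' = increasing⇒injective (λ x → x + x) (λ a<b → +-mono-< a<b a<b)
               (trans (double x∈) (trans (cong₂ _+_ (cong proj₁ toRep≡) (cong proj₂ toRep≡)) (sym (double y∈))))
      u≡u' : u ≡ u'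
      u≡u' = +-cancelʳ-≡ v u u' (trans (cong proj₁ toRep≡) (cong (u' +_) (sym v≡v')))

    toRep-sound : ∀ {x} → x ∈ below → Representations n (toRep x)
    toRep-sound {u , v} x∈ with ∈-filter⁻ below? {xs = pairs} x∈
    ... | uv∈ , u<v = proj₁ (rep-from-pair (trans n≡4M (cong (4 *_) (sym (pair-product uv∈)))) u<v)

    n-even : Even n
    n-even = 2 * M , trans n≡4M (*-assoc 2 2 M)

    -- A representation (k , l) comes from the pair (u , u + l) with k = 2u + l.
    toRep-complete : ∀ {kl} → Representations n kl → kl ∈ reps
    toRep-complete {k , l} rep@(_ , l>0 , _) with even-rep-structure n-even rep
    ... | u , k≡ , n≡ = subst (_∈ reps) (cong₂ _,_ (sym k≡) (m+n∸m≡n u l)) (∈-map⁺ toRep pair∈)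
      where
      pair∈ : (u , u + l) ∈ below
      pair∈ = ∈-filter⁺ below? (pair-complete (*-cancelˡ-≡ _ _ 4 (trans (sym n≡) n≡4M))) (m<m+n u l>0)

    mirror : ∀ {P Q : ℕ × ℕ → Set} (P? : ∀ x → Dec (P x)) (Q? : ∀ x → Dec (Q x)) →
             (∀ {x} → P x → Q (swap x)) → ∀ {x} → x ∈ map swap (filter P? pairs) → x ∈ filter Q? pairs
    mirror P? Q? P⇒Q x∈ with ∈-map⁻ swap x∈
    ... | (u , v) , uv∈ , refl with ∈-filter⁻ P? {xs = pairs} uv∈
    ... | uv∈pairs , Puv = ∈-filter⁺ Q? (pair-complete (trans (*-comm v u) (pair-product uv∈pairs))) (P⇒Q Puv)

    below≡above : length below ≡ length above
    below≡above = trans (sym (length-map swap below))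
      (same-members⇒same-length (map swap below) above
         (map⁺ (cong swap) (filter⁺ below? unique-pairs)) (filter⁺ above? unique-pairs)
         (mirror below? above? (λ u<v → u<v))
         (λ x∈ → ∈-map⁺ swap (mirror above? below? (λ v<u → v<u) (∈-map⁺ swap x∈))))

    pair-count : 2 * length below + length diagonal ≡ exponentFactor fs
    pair-count = begin
      2 * length below + length diagonal                        ≡⟨ cong (λ z → length below + z + length diagonal)
                                                                      (trans (+-identityʳ (length below)) below≡above) ⟩
      length below + length above + length diagonal             ≡⟨ +-right-swap (length below) (length above) (length diagonal) ⟩
      length below + length diagonal + length above             ≡⟨ trichotomy-length pairs ⟩
      length pairs                                              ≡⟨ divisorPairs-length fs ⟩
      exponentFactor fs                                         ∎
      where
      open ≡-Reasoning
      +-right-swap : ∀ a b c → a + b + c ≡ a + c + b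
      +-right-swap = solve-∀

    diagonal⇒square : ∀ {x} → x ∈ diagonal → IsSquare n
    diagonal⇒square {u , v} x∈ with ∈-filter⁻ diagonal? {xs = pairs} x∈
    ... | uu∈ , refl = 2 * u , trans (regroup u) (trans (cong (4 *_) (pair-product uu∈)) (sym n≡4M))
      where
      regroup : ∀ u → 2 * u * (2 * u) ≡ 4 * (u * u)
      regroup = solve-∀

    -- A square root of n = 4M is even, and half of it is a square root of M.
    square-quarter : IsSquare n → IsSquare M
    square-quarter (m , m²≡n) = q , q²≡M
      where
      regroup₁ : ∀ M → 4 * M ≡ 2 * M * 2
      regroup₁ = solve-∀
      regroup₂ : ∀ q → 4 * (q * q) ≡ q * 2 * (q * 2)
      regroup₂ = solve-∀
      2∣m : 2 ∣ m
      2∣m = prime∣square⇒∣ prime[2] (divides (2 * M) (trans m²≡n (trans n≡4M (regroup₁ M))))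
      q : ℕ
      q = quotient 2∣m
      q²≡M : q * q ≡ M
      q²≡M = *-cancelˡ-≡ (q * q) M 4 (begin
        4 * (q * q)         ≡⟨ regroup₂ q ⟩
        q * 2 * (q * 2)     ≡⟨ cong (λ z → z * z) (sym (m∣n⇒n≡quotient*m 2∣m)) ⟩
        m * m               ≡⟨ m²≡n ⟩
        n                   ≡⟨ n≡4M ⟩
        4 * M               ∎)
        where open ≡-Reasoning

    diagonal-empty : ¬ IsSquare n → length diagonal ≡ 0
    diagonal-empty non-square = n≤0⇒n≡0 (unique⊆⇒length≤ diagonal [] (filter⁺ diagonal? unique-pairs)
                                           (λ x∈ → ⊥-elim (non-square (diagonal⇒square x∈))))

    diagonal-single : IsSquare n → length diagonal ≡ 1
    diagonal-single square = same-members⇒same-length diagonal [ (t , t) ]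
                               (filter⁺ diagonal? unique-pairs) (All.[] ∷ []) only-root root∈
      where
      root : IsSquare M
      root = square-quarter square
      t : ℕ
      t = proj₁ root
      t²≡M : t * t ≡ M
      t²≡M = proj₂ root
      only-root : ∀ {x} → x ∈ diagonal → x ∈ [ (t , t) ]
      only-root {u , v} x∈ with ∈-filter⁻ diagonal? {xs = pairs} x∈
      ... | uu∈ , refl = here (cong₂ _,_ u≡t u≡t)
        where
        u≡t : u ≡ t
        u≡t = increasing⇒injective (λ x → x * x) (λ a<b → *-mono-< a<b a<b) (trans (pair-product uu∈) (sym t²≡M))
      root∈ : ∀ {x} → x ∈ [ (t , t) ] → x ∈ diagonal
      root∈ (here refl) = ∈-filter⁺ diagonal? (pair-complete t²≡M) refl

    rep-card : HasCard (Representations n) (length below)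
    rep-card = reps , map-unique toRep below toRep-injective (filter⁺ below? unique-pairs) ,
               (λ kl → mk⇔ reps⇒rep toRep-complete) , length-map toRep below
      where
      reps⇒rep : ∀ {kl} → kl ∈ reps → Representations n kl
      reps⇒rep kl∈ with ∈-map⁻ toRep kl∈
      ... | x , x∈ , refl = toRep-sound x∈

  count-nonsquare : ¬ IsSquare n → ∃[ N ] (HasCard (Representations n) N × 2 * N ≡ exponentFactor fs)
  count-nonsquare non-square = length below , rep-card ,
    trans (sym (+-identityʳ _)) (trans (cong (2 * length below +_) (sym (diagonal-empty non-square))) pair-count)

  count-square : IsSquare n → ∃[ N ] (HasCard (Representations n) N × 2 * N + 1 ≡ exponentFactor fs)
  count-square square = length below , rep-card ,
    trans (cong (2 * length below +_) (sym (diagonal-single square))) pair-count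

odd⇒even-suc : ∀ {s} → Odd s → Even (suc s)
odd⇒even-suc (t , s≡1+2t) = suc t , trans (cong suc s≡1+2t) (sym (*-suc 2 t))

even-suc⇒odd : ∀ {s} → Even (suc s) → Odd s
even-suc⇒odd (suc t , s+1≡2t+2) = t , suc-injective (trans s+1≡2t+2 (*-suc 2 t))

square-criterion : ∀ {n} s ps → DistinctPrimes ((2 , suc s) ∷ ps) → n ≡ 2 ^ suc s * primePowerProduct ps →
                   IsSquare n ⇔ (Odd s × All (λ f → Even (proj₂ f)) ps)
square-criterion s ps distinct refl = mk⇔ to from
  where
  to : IsSquare (2 ^ suc s * primePowerProduct ps) → Odd s × All (λ f → Even (proj₂ f)) ps
  to square with square⇒even-exponents ((2 , suc s) ∷ ps) distinct square
  ... | even-suc All.∷ evens = even-suc⇒odd even-suc , evens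
  from : Odd s × All (λ f → Even (proj₂ f)) ps → IsSquare (2 ^ suc s * primePowerProduct ps)
  from (s-odd , evens) = even-exponents⇒square ((2 , suc s) ∷ ps) (odd⇒even-suc s-odd All.∷ evens)

-- For s = 0 there is no representation at all
-- (it would force 4 ∣ 2P), and n is no square; for s > 0 it is the divisor-pair count
-- of n/4 = 2^(s−1) P, which has s · ∏ (s_j + 1) divisor pairs.
representation-count : ∀ {n} s ps → (∀ e → DistinctPrimes ((2 , e) ∷ ps)) → n ≡ 2 ^ suc s * primePowerProduct ps →
  (¬ IsSquare n → ∃[ N ] (HasCard (Representations n) N × 2 * N ≡ s * exponentFactor ps)) ×
  (IsSquare n → ∃[ N ] (HasCard (Representations n) N × 2 * N + 1 ≡ s * exponentFactor ps))
representation-count {n} zero ps distinct n≡2P = (λ _ → 0 , no-representations , refl) , λ square →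
  ⊥-elim (odd-zero (Equivalence.to (square-criterion 0 ps (distinct 1) n≡2P) square))
  where
  P : ℕ
  P = primePowerProduct ps
  odd-zero : ∀ {A : Set} → Odd 0 × A → ⊥
  odd-zero ((_ , ()) , _)
  no-rep : ∀ kl → ¬ Representations n kl
  no-rep (k , l) rep = head∤tail (distinct 0) (*-cancelˡ-∣ 2 (subst (4 ∣_) n≡2P (rep⇒4∣ (P , n≡2P) rep)))
  no-representations : HasCard (Representations n) 0
  no-representations = [] , [] , (λ kl → mk⇔ (λ ()) (λ rep → ⊥-elim (no-rep kl rep))) , refl
representation-count {n} (suc s) ps distinct n≡ = count-nonsquare , count-square
  where
  regroup : ∀ x P → 2 * (2 * x) * P ≡ 4 * (x * P)
  regroup = solve-∀
  open RepresentationCount ((2 , s) ∷ ps) (distinct s) n (trans n≡ (regroup (2 ^ s) (primePowerProduct ps)))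

mainTheorem6 : (n s₁ : ℕ) (ps : List (ℕ × ℕ)) →
    All (λ ps' → Prime (proj₁ ps') × Odd (proj₁ ps') × 1 ≤ proj₂ ps') ps →
    Unique (map proj₁ ps) →
    n ≡ 2 ^ (s₁ + 1) * primePowerProduct ps →
    ((∀ d → Admissible n d → ∃[ k ] ∃[ l ] (Param n d k l × Rep n k l)) ×
     (∀ k l → Rep n k l → ∃[ d ] (Admissible n d × Param n d k l)) ×
     (∀ d d' k l → Admissible n d → Admissible n d' →
        Param n d k l → Param n d' k l → d ≡ d')) ×
    (IsSquare n ⇔ (Odd s₁ × All (λ ps' → Even (proj₂ ps')) ps)) ×
    (¬ IsSquare n → ∃[ N ] (HasCard (λ kl → Rep n (proj₁ kl) (proj₂ kl)) N ×
                             2 * N ≡ s₁ * exponentFactor ps)) ×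
    (IsSquare n → ∃[ N ] (HasCard (λ kl → Rep n (proj₁ kl) (proj₂ kl)) N ×
                           2 * N + 1 ≡ s₁ * exponentFactor ps)) ×
    (n % 4 ≡ 2 → ∀ k l → ¬ Rep n k l)
mainTheorem6 n s₁ ps odd-primes unique-ps n≡ =
  ( (λ d → admissible⇒rep {n} {m} {d} n≡2m)
  , (λ k l → rep⇒admissible n>0 (m , n≡2m))
  , (λ d d' k l adm adm' → param-unique (admissible⇒positive adm) (admissible⇒positive adm')) ) ,
  square-criterion s₁ ps (with-2 (suc s₁)) n≡2^[s₁+1]P ,
  proj₁ counts , proj₂ counts ,
  no-rep-mod4
  where
  P : ℕ
  P = primePowerProduct ps
  with-2 : ∀ e → DistinctPrimes ((2 , e) ∷ ps)
  with-2 e = prime[2] All.∷ All.map proj₁ odd-primes ,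
             AllP.map⁺ (All.map (λ { (_ , (t , p≡1+2t) , _) 2≡p → even≢odd 1 t (trans 2≡p p≡1+2t) }) odd-primes)
             ∷ unique-ps
  n≡2^[s₁+1]P : n ≡ 2 ^ suc s₁ * P
  n≡2^[s₁+1]P = trans n≡ (cong (λ e → 2 ^ e * P) (+-comm s₁ 1))
  m : ℕ
  m = 2 ^ s₁ * P
  n≡2m : n ≡ 2 * m
  n≡2m = trans n≡2^[s₁+1]P (*-assoc 2 (2 ^ s₁) P)
  P>0 : 0 < P
  P>0 = n≢0⇒n>0 (λ P≡0 → head∤tail (with-2 0) (subst (2 ∣_) (sym P≡0) (2 ∣0)))
  n>0 : 0 < n
  n>0 = subst (0 <_) (sym n≡2^[s₁+1]P) (m*n>0 (m^n>0 2 (suc s₁)) P>0)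
  counts : (¬ IsSquare n → ∃[ N ] (HasCard (Representations n) N × 2 * N ≡ s₁ * exponentFactor ps)) ×
           (IsSquare n → ∃[ N ] (HasCard (Representations n) N × 2 * N + 1 ≡ s₁ * exponentFactor ps))
  counts = representation-count s₁ ps with-2 n≡2^[s₁+1]P
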